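{- Let $(U_i)_{i\ge0}$ be defined by $U_0=1$, $U_1=13$, $U_2=163$ and $U_{i+3}=12U_{i+2}+6U_{i+1}+12U_i$ for all $i\ge0$. There exists a unique $2$-adic integer $\zeta$ with the property that if $(i_n)_{n\ge0}$ is a sequence of non-negative integers such that $\nu_2(U_{i_n})-\frac{i_n}{2}\to\infty$, then $i_n\to\zeta$ in $\mathbb{Z}_2$.
   Context: $\nu_2$ denotes the $2$-adic valuation and $\mathbb{Z}_2$ the ring of $2$-adic integers with its $2$-adic topology. -}

module Defs where

open import Data.Nat using (ℕ; zero; suc; _+_; _*_; _^_; _≤_; _%_; _/_)
open import Data.Bool using (Bool; true; false; if_then_else_)
open import Data.Nat.Properties using (m^n≢0)
open import Relation.Binary.PropositionalEquality using (_≡_)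
open import Data.Product using (Σ; _×_; ∃-syntax)

Utriple : ℕ → ℕ × ℕ × ℕ
Utriple zero = 1 Data.Product., 13 Data.Product., 163
Utriple (suc i) with Utriple i
... | a Data.Product., b Data.Product., c = b Data.Product., c Data.Product., (12 * c + 6 * b + 12 * a)

U : ℕ → ℕ
U i = Data.Product.proj₁ (Utriple i)

-- 2-adic valuation of a natural number (fuel = n suffices; ν₂ 0 = 0 by convention,
-- irrelevant here since every U i ≥ 1).
ν₂-go : ℕ → ℕ → ℕ
ν₂-go zero n = 0
ν₂-go (suc f) zero = 0
ν₂-go (suc f) (suc m) with suc m % 2
... | zero = suc (ν₂-go f (suc m / 2))
... | suc _ = 0

ν₂ : ℕ → ℕ
ν₂ n = ν₂-go n n

-- 2-adic integers as digit sequences: ζ = Σ_j ζ j · 2^j.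
ℤ₂ : Set
ℤ₂ = ℕ → Bool

bit : Bool → ℕ
bit true = 1
bit false = 0

trunc : ℤ₂ → ℕ → ℕ
trunc ζ zero = 0
trunc ζ (suc k) = trunc ζ k + bit (ζ k) * 2 ^ k

ConvergesTo₂ : (ℕ → ℕ) → ℤ₂ → Set
ConvergesTo₂ i ζ = ∀ k → ∃[ N ] ∀ n → N ≤ n → _%_ (i n) (2 ^ k) {{m^n≢0 2 k}} ≡ trunc ζ k

-- ν₂(U_{i_n}) − i_n / 2 → ∞ , i.e. for every M eventually
-- ν₂(U_{i_n}) − i_n/2 ≥ M, equivalently i_n + 2M ≤ 2 ν₂(U_{i_n}).
ValuationGapDiverges : (ℕ → ℕ) → Set
ValuationGapDiverges i = ∀ M → ∃[ N ] ∀ n → N ≤ n → i n + 2 * M ≤ 2 * ν₂ (U (i n))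

Property : ℤ₂ → Set
Property ζ = ∀ (i : ℕ → ℕ) → ValuationGapDiverges i → ConvergesTo₂ i ζ

-- The valuation gap 2 ν₂(U i) - i is negative unless i = 1 + 4p, where U i = 4^p G p and the gap is
-- 2 ν₂(G p) - 1.  The integers G p satisfy a third-order linear recurrence whose characteristic
-- polynomial is X(X - 1)² modulo 4; squaring its roots over and over shows that along every step 2^j
-- the second differences of G vanish modulo 16·2^j, whence G a - G b ≡ 4(a - b) mod 8·2^j whenever
-- a ≡ b mod 2^j.  So G is 2-adically an affine map of slope 4: it vanishes to order 2 + k on exactly
-- one residue class ρ k mod 2^k, and these classes are the truncations of a 2-adic integer ξ (Hensel).
-- As ν₂(G p) ≤ G p and G is increasing, a large gap forces p to be large and hence p ≡ ρ k, i.e.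
-- i → 1 + 4ξ.  The indices 1 + 4(ρ n + 4·2^n) have unbounded gap, which gives uniqueness.

module Submission where

open import Defs
open import Data.Product using (Σ; _×_; ∃-syntax)
open import Relation.Binary.PropositionalEquality using (_≡_)
open import Data.Product using (_,_)

module Congruence where
  open import Data.Integer
  open import Data.Integer.Properties
    using (+-inverseʳ; +-identityʳ; +-identityˡ; *-identityʳ; *-identityˡ; *-zeroˡ; pos-*; pos-+;
           +-minus-telescope; [+m]-[+n]≡m⊖n; ⊖-≥)
  open import Data.Integer.Divisibility.Signed
  open import Data.Integer.Tactic.RingSolver using (solve-∀)
  import Data.Nat as ℕ
  import Data.Nat.Properties as ℕ
  import Data.Nat.DivMod as ℕ
  import Data.Nat.Divisibility as ℕ
  open import Data.Product using (_,_; ∃-syntax)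
  open import Data.Sum using (inj₁; inj₂)
  open import Data.Empty using (⊥-elim)
  open import Relation.Nullary using (¬_; Dec)
  import Relation.Nullary.Decidable as Dec
  open import Data.Integer.DivMod using (_%ℕ_; _/ℕ_; n%ℕd<d; a≡a%ℕn+[a/ℕn]*n)
  open import Relation.Binary.PropositionalEquality
  open import Relation.Binary.Bundles using (Setoid)
  open import Relation.Binary.Structures using (IsEquivalence)
  import Relation.Binary.Reasoning.Setoid as SetoidReasoning

  infix 4 _≡_mod_ _≡?_mod_
  record _≡_mod_ (x y : ℤ) (m : ℕ.ℕ) : Set where
    constructor mod-intro
    field ∣-difference : + m ∣ x - y
  open _≡_mod_ public

  ≡-mod-reflexive : ∀ {x y m} → x ≡ y → x ≡ y mod m
  ≡-mod-reflexive {x} {m = m} refl = mod-intro (divides 0ℤ (trans (+-inverseʳ x) (sym (*-zeroˡ (+ m)))))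

  ≡-mod-sym : ∀ {x y m} → x ≡ y mod m → y ≡ x mod m
  ≡-mod-sym {x} {y} (mod-intro m∣x-y) = mod-intro (subst (_ ∣_) (swap x y) (∣m⇒∣-m m∣x-y))
    where
    swap : ∀ x y → - (x - y) ≡ y - x
    swap = solve-∀

  ≡-mod-trans : ∀ {x y z m} → x ≡ y mod m → y ≡ z mod m → x ≡ z mod m
  ≡-mod-trans {x} {y} {z} (mod-intro m∣x-y) (mod-intro m∣y-z) =
    mod-intro (subst (_ ∣_) (+-minus-telescope x y z) (∣m∣n⇒∣m+n m∣x-y m∣y-z))

  ≡-mod-isEquivalence : ∀ m → IsEquivalence (_≡_mod m)
  ≡-mod-isEquivalence m = record { refl = ≡-mod-reflexive refl ; sym = ≡-mod-sym ; trans = ≡-mod-trans }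

  ≡-mod-setoid : ℕ.ℕ → Setoid _ _
  ≡-mod-setoid m = record { isEquivalence = ≡-mod-isEquivalence m }

  module ≡-mod-Reasoning (m : ℕ.ℕ) = SetoidReasoning (≡-mod-setoid m)

  ≡-mod-+ : ∀ {x y u v m} → x ≡ y mod m → u ≡ v mod m → x + u ≡ y + v mod m
  ≡-mod-+ {x} {y} {u} {v} (mod-intro m∣x-y) (mod-intro m∣u-v) =
    mod-intro (subst (_ ∣_) (regroup x y u v) (∣m∣n⇒∣m+n m∣x-y m∣u-v))
    where
    regroup : ∀ x y u v → (x - y) + (u - v) ≡ (x + u) - (y + v)
    regroup = solve-∀

  ≡-mod-neg : ∀ {x y m} → x ≡ y mod m → - x ≡ - y mod m
  ≡-mod-neg {x} {y} (mod-intro m∣x-y) = mod-intro (subst (_ ∣_) (negate x y) (∣m⇒∣-m m∣x-y))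
    where
    negate : ∀ x y → - (x - y) ≡ - x - - y
    negate = solve-∀

  ≡-mod-cast : ∀ {x y m n} → m ≡ n → x ≡ y mod m → x ≡ y mod n
  ≡-mod-cast refl x≡y = x≡y

  ≡-mod-+ˡ : ∀ z {x y m} → x ≡ y mod m → z + x ≡ z + y mod m
  ≡-mod-+ˡ z = ≡-mod-+ (≡-mod-reflexive {z} refl)

  private
    *-distribˡ-minus : ∀ k x y → k * (x - y) ≡ k * x - k * y
    *-distribˡ-minus = solve-∀

  ≡-mod-scale : ∀ k {x y m} → x ≡ y mod m → + k * x ≡ + k * y mod k ℕ.* m
  ≡-mod-scale k {x} {y} {m} (mod-intro m∣x-y) =
    mod-intro (subst₂ _∣_ (sym (pos-* k m)) (*-distribˡ-minus (+ k) x y) (*-monoʳ-∣ (+ k) m∣x-y))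

  ≡-mod-cancel : ∀ k {x y m} .{{_ : ℕ.NonZero k}} → + k * x ≡ + k * y mod k ℕ.* m → x ≡ y mod m
  ≡-mod-cancel k {x} {y} {m} (mod-intro km∣kx-ky) =
    mod-intro (*-cancelˡ-∣ (+ k) (subst₂ _∣_ (pos-* k m) (sym (*-distribˡ-minus (+ k) x y)) km∣kx-ky))

  ≡-mod-weaken : ∀ {x y m n} → m ℕ.∣ n → x ≡ y mod n → x ≡ y mod m
  ≡-mod-weaken {m = m} {n} m∣n (mod-intro n∣x-y) = mod-intro (∣-trans (∣ᵤ⇒∣ {+ m} {+ n} m∣n) n∣x-y)

  ≡-mod-intro : ∀ {x y m} q → x ≡ y + q * + m → x ≡ y mod m
  ≡-mod-intro {y = y} {m} q refl = mod-intro (divides q (cancel y (q * + m)))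
    where
    cancel : ∀ y d → y + d - y ≡ d
    cancel = solve-∀

  ≡-mod-elim : ∀ {x y m} → x ≡ y mod m → ∃[ q ] x ≡ y + q * + m
  ≡-mod-elim {x} {y} (mod-intro (divides q x-y≡q*m)) = q , (begin
    x                 ≡⟨ complete x y ⟩
    y + (x - y)       ≡⟨ cong (λ d → y + d) x-y≡q*m ⟩
    y + q * _         ∎)
    where
    open ≡-Reasoning
    complete : ∀ x y → x ≡ y + (x - y)
    complete = solve-∀

  ≡-mod-intro* : ∀ {x y} k n q → x ≡ y + q * (+ k * + n) → x ≡ y mod k ℕ.* n
  ≡-mod-intro* {y = y} k n q x≡y+q*kn = ≡-mod-intro q (trans x≡y+q*kn (cong (λ m → y + q * m) (sym (pos-* k n))))

  ≡-mod-elim* : ∀ {x y} k n → x ≡ y mod k ℕ.* n → ∃[ q ] x ≡ y + q * (+ k * + n)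
  ≡-mod-elim* {y = y} k n x≡y with ≡-mod-elim x≡y
  ... | q , x≡y+q*kn = q , trans x≡y+q*kn (cong (λ m → y + q * m) (pos-* k n))

  ≡-mod-*-≡0 : ∀ {x y m n} → x ≡ 0ℤ mod m → y ≡ 0ℤ mod n → x * y ≡ 0ℤ mod m ℕ.* n
  ≡-mod-*-≡0 {m = m} {n} x≡0 y≡0 with ≡-mod-elim x≡0 | ≡-mod-elim y≡0
  ... | a , refl | b , refl =
    ≡-mod-intro (a * b) (trans (regroup a b (+ m) (+ n)) (cong (λ k → 0ℤ + a * b * k) (sym (pos-* m n))))
    where
    regroup : ∀ a b m n → (0ℤ + a * m) * (0ℤ + b * n) ≡ 0ℤ + a * b * (m * n)
    regroup = solve-∀

  ≡-mod-difference : ∀ {x y m} → x ≡ y mod m → x - y ≡ 0ℤ mod m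
  ≡-mod-difference {x} {y} (mod-intro m∣x-y) = mod-intro (subst (_ ∣_) (sym (+-identityʳ (x - y))) m∣x-y)

  ≡-mod-1 : ∀ {x y} → x ≡ y mod 1
  ≡-mod-1 {x} {y} = mod-intro (divides (x - y) (sym (*-identityʳ (x - y))))

  ≡-mod-from-difference : ∀ {x y m} → x - y ≡ 0ℤ mod m → x ≡ y mod m
  ≡-mod-from-difference {x} {y} (mod-intro m∣x-y-0) = mod-intro (subst (_ ∣_) (+-identityʳ (x - y)) m∣x-y-0)

  offset⇒≡-mod : ∀ a q m → + (a ℕ.+ q ℕ.* m) ≡ + a mod m
  offset⇒≡-mod a q m = ≡-mod-intro (+ q) (trans (pos-+ a (q ℕ.* m)) (cong (λ z → + a + z) (pos-* q m)))

  half-residue : ∀ {x m} → x ≡ 0ℤ mod m → ¬ (x ≡ 0ℤ mod 2 ℕ.* m) → x ≡ + m mod 2 ℕ.* m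
  half-residue {x} {m} x≡0 x≢0 with ≡-mod-elim x≡0
  ... | q , refl with q %ℕ 2 | n%ℕd<d q 2 | a≡a%ℕn+[a/ℕn]*n q 2
  ...   | 0 | _ | q≡2t = ⊥-elim (x≢0 (≡-mod-intro* 2 m (q /ℕ 2) (begin
    0ℤ + q * + m                      ≡⟨ cong (λ z → 0ℤ + z * + m) q≡2t ⟩
    0ℤ + (+ 0 + q /ℕ 2 * + 2) * + m   ≡⟨ even (q /ℕ 2) (+ m) ⟩
    0ℤ + q /ℕ 2 * (+ 2 * + m)         ∎)))
    where
    open ≡-Reasoning
    even : ∀ t m → 0ℤ + (+ 0 + t * + 2) * m ≡ 0ℤ + t * (+ 2 * m)
    even = solve-∀
  ...   | 1 | _ | q≡1+2t = ≡-mod-intro* 2 m (q /ℕ 2) (begin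
    0ℤ + q * + m                      ≡⟨ cong (λ z → 0ℤ + z * + m) q≡1+2t ⟩
    0ℤ + (+ 1 + q /ℕ 2 * + 2) * + m   ≡⟨ odd (q /ℕ 2) (+ m) ⟩
    m′ + q /ℕ 2 * (+ 2 * m′)          ∎)
    where
    open ≡-Reasoning
    m′ = + m
    odd : ∀ t m → 0ℤ + (+ 1 + t * + 2) * m ≡ m + t * (+ 2 * m)
    odd = solve-∀
  ...   | ℕ.suc (ℕ.suc _) | ℕ.s≤s (ℕ.s≤s ()) | _

  ≡-mod-self : ∀ m → + m ≡ 0ℤ mod m
  ≡-mod-self m = ≡-mod-intro (+ 1) (sym (trans (+-identityˡ (+ 1 * + m)) (*-identityˡ (+ m))))

  ≡-mod-twice-self : ∀ m → + m + + m ≡ 0ℤ mod 2 ℕ.* m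
  ≡-mod-twice-self m = ≡-mod-intro* 2 m (+ 1) (twice (+ m))
    where
    twice : ∀ x → x + x ≡ 0ℤ + + 1 * (+ 2 * x)
    twice = solve-∀

  _≡?_mod_ : ∀ x y m → Dec (x ≡ y mod m)
  x ≡? y mod m = Dec.map′ mod-intro ∣-difference (+ m ∣? (x - y))

  ∣⇒≡0-mod : ∀ {m n} → m ℕ.∣ n → + n ≡ 0ℤ mod m
  ∣⇒≡0-mod {m} {n} m∣n = mod-intro (subst (+ m ∣_) (sym (+-identityʳ (+ n))) (∣ᵤ⇒∣ {+ m} {+ n} m∣n))

  ≡0-mod⇒∣ : ∀ {m n} → + n ≡ 0ℤ mod m → m ℕ.∣ n
  ≡0-mod⇒∣ {m} {n} (mod-intro m∣n-0) = ∣⇒∣ᵤ {+ m} {+ n} (subst (+ m ∣_) (+-identityʳ (+ n)) m∣n-0)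

  ≡-mod⇒offset : ∀ {a b m} → + a ≡ + b mod m → b ℕ.≤ a → ∃[ q ] a ≡ b ℕ.+ q ℕ.* m
  ≡-mod⇒offset {a} {b} {m} (mod-intro m∣a-b) b≤a with ∣⇒∣ᵤ (subst (+ m ∣_) +a-+b≡+[a∸b] m∣a-b)
    where
    +a-+b≡+[a∸b] : + a - + b ≡ + (a ℕ.∸ b)
    +a-+b≡+[a∸b] = trans ([+m]-[+n]≡m⊖n a b) (⊖-≥ b≤a)
  ... | ℕ.divides q a∸b≡q*m = q , trans (sym (ℕ.m+[n∸m]≡n b≤a)) (cong (b ℕ.+_) a∸b≡q*m)

  ≡-mod⇒%≡ : ∀ {a b m} .{{_ : ℕ.NonZero m}} → + a ≡ + b mod m → b ℕ.< m → a ℕ.% m ≡ b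
  ≡-mod⇒%≡ {a} {b} {m} a≡b b<m with ℕ.≤-total b a
  ... | inj₁ b≤a with ≡-mod⇒offset a≡b b≤a
  ...   | q , a≡b+q*m = trans (cong (ℕ._% m) a≡b+q*m) (trans (ℕ.[m+kn]%n≡m%n b q m) (ℕ.m<n⇒m%n≡m b<m))
  ≡-mod⇒%≡ {a} {b} {m} a≡b b<m | inj₂ a≤b with ≡-mod⇒offset (≡-mod-sym a≡b) a≤b
  ...   | ℕ.zero , b≡a+0 = trans (ℕ.m<n⇒m%n≡m (subst (ℕ._< m) b≡a b<m)) (sym b≡a)
    where
    b≡a : b ≡ a
    b≡a = trans b≡a+0 (ℕ.+-identityʳ a)
  ...   | ℕ.suc q , b≡a+[1+q]*m = ⊥-elim (ℕ.<⇒≱ b<m (subst (m ℕ.≤_) (sym b≡a+[1+q]*m) m≤a+[1+q]*m))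
    where
    m≤a+[1+q]*m : m ℕ.≤ a ℕ.+ ℕ.suc q ℕ.* m
    m≤a+[1+q]*m = ℕ.m≤n⇒m≤o+n a (ℕ.m≤m+n m (q ℕ.* m))

module Valuation where
  open import Data.Nat
  open import Data.Nat.Properties
  open import Data.Nat.DivMod
  open import Data.Nat.Divisibility
  open import Data.Product using (_,_; ∃-syntax)
  open import Data.Empty using (⊥-elim)
  open import Function using (_∘_)
  open import Relation.Nullary using (yes; no; ¬_)
  open import Relation.Binary.PropositionalEquality

  ν₂-go≤fuel : ∀ f n → ν₂-go f n ≤ f
  ν₂-go≤fuel zero n = z≤n
  ν₂-go≤fuel (suc f) zero = z≤n
  ν₂-go≤fuel (suc f) (suc m) with suc m % 2
  ... | zero = s≤s (ν₂-go≤fuel f (suc m / 2))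
  ... | suc _ = z≤n

  ν₂≤ : ∀ n → ν₂ n ≤ n
  ν₂≤ n = ν₂-go≤fuel n n

  odd%2 : ∀ a → (1 + 2 * a) % 2 ≡ 1
  odd%2 a = trans (cong (_% 2) (cong suc (*-comm 2 a))) ([m+kn]%n≡m%n 1 a 2)

  ν₂-go-odd : ∀ f a → ν₂-go (suc f) (1 + 2 * a) ≡ 0
  ν₂-go-odd f a rewrite odd%2 a = refl

  ν₂-go-even : ∀ f a → ν₂-go (suc f) (2 * suc a) ≡ suc (ν₂-go f (suc a))
  ν₂-go-even f a rewrite trans (cong (_% 2) (*-comm 2 (suc a))) (m*n%n≡0 (suc a) 2)
    = cong (suc ∘ ν₂-go f) (trans (cong (_/ 2) (*-comm 2 (suc a))) (m*n/n≡m (suc a) 2))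

  2^k*odd>0 : ∀ k a → 0 < 2 ^ k * (1 + 2 * a)
  2^k*odd>0 k a = >-nonZero⁻¹ _ {{m*n≢0 (2 ^ k) (1 + 2 * a) {{m^n≢0 2 k}}}}

  half-fuel : ∀ {n f} → 0 < n → 2 * n ≤ suc f → n ≤ f
  half-fuel {n} {f} 0<n 2n≤1+f = ≤-pred (begin
    suc n     ≡⟨ +-comm 1 n ⟩
    n + 1     ≤⟨ +-monoʳ-≤ n 0<n ⟩
    n + n     ≡⟨ cong (n +_) (+-identityʳ n) ⟨
    2 * n     ≤⟨ 2n≤1+f ⟩
    suc f     ∎)
    where open ≤-Reasoning

  ν₂-go-2^k*odd : ∀ k a f → 2 ^ k * (1 + 2 * a) ≤ f → ν₂-go f (2 ^ k * (1 + 2 * a)) ≡ k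
  ν₂-go-2^k*odd zero a (suc f) _ =
    subst (λ n → ν₂-go (suc f) n ≡ 0) (sym (*-identityˡ (1 + 2 * a))) (ν₂-go-odd f a)
  ν₂-go-2^k*odd (suc k) a f n≤f
    rewrite *-assoc 2 (2 ^ k) (1 + 2 * a)
    with 2 ^ k * (1 + 2 * a) in eq | 2^k*odd>0 k a
  ν₂-go-2^k*odd (suc k) a (suc f) n≤f | suc b | 0<n =
    trans (ν₂-go-even f b)
          (cong suc (trans (cong (ν₂-go f) (sym eq)) (ν₂-go-2^k*odd k a f (subst (_≤ f) (sym eq) (half-fuel 0<n n≤f)))))

  ν₂-2^k*odd : ∀ k a → ν₂ (2 ^ k * (1 + 2 * a)) ≡ k
  ν₂-2^k*odd k a = ν₂-go-2^k*odd k a _ ≤-refl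

  ν₂-go-decomposition : ∀ f n → 0 < n → n ≤ f → ∃[ a ] n ≡ 2 ^ ν₂-go f n * (1 + 2 * a)
  ν₂-go-decomposition (suc f) (suc m) _ 1+m≤1+f with suc m % 2 in eq | m≡m%n+[m/n]*n (suc m) 2
  ... | zero | 1+m≡h*2 with ν₂-go-decomposition f (suc m / 2) 0<h h≤f
    where
    0<h : 0 < suc m / 2
    0<h with suc m / 2
    ... | suc _ = z<s
    h≤f : suc m / 2 ≤ f
    h≤f = ≤-pred (<-≤-trans (m/n<m (suc m) 2 (s≤s (s≤s z≤n))) 1+m≤1+f)
  ...   | a , h≡2^ν*odd = a , (begin
    suc m                                    ≡⟨ 1+m≡h*2 ⟩
    suc m / 2 * 2                            ≡⟨ *-comm (suc m / 2) 2 ⟩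
    2 * (suc m / 2)                          ≡⟨ cong (2 *_) h≡2^ν*odd ⟩
    2 * (2 ^ ν₂-go f (suc m / 2) * (1 + 2 * a)) ≡⟨ *-assoc 2 (2 ^ ν₂-go f (suc m / 2)) (1 + 2 * a) ⟨
    2 ^ suc (ν₂-go f (suc m / 2)) * (1 + 2 * a) ∎)
    where open ≡-Reasoning
  ν₂-go-decomposition (suc f) (suc m) _ _ | suc zero | 1+m≡1+h*2 =
    suc m / 2 , trans 1+m≡1+h*2 (cong suc (trans (*-comm (suc m / 2) 2) (sym (+-identityʳ _))))
  ν₂-go-decomposition (suc f) (suc m) _ _ | suc (suc r) | _ =
    ⊥-elim (<⇒≱ (m%n<n (suc m) 2) (subst (2 ≤_) (sym eq) (s≤s (s≤s z≤n))))

  ν₂-decomposition : ∀ n → 0 < n → ∃[ a ] n ≡ 2 ^ ν₂ n * (1 + 2 * a)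
  ν₂-decomposition n 0<n = ν₂-go-decomposition n n 0<n ≤-refl

  ν₂-2^k* : ∀ k n → 0 < n → ν₂ (2 ^ k * n) ≡ k + ν₂ n
  ν₂-2^k* k n 0<n with ν₂-decomposition n 0<n
  ... | a , n≡2^ν*odd = begin
    ν₂ (2 ^ k * n)                        ≡⟨ cong (λ m → ν₂ (2 ^ k * m)) n≡2^ν*odd ⟩
    ν₂ (2 ^ k * (2 ^ ν₂ n * (1 + 2 * a))) ≡⟨ cong ν₂ (*-assoc (2 ^ k) (2 ^ ν₂ n) (1 + 2 * a)) ⟨
    ν₂ (2 ^ k * 2 ^ ν₂ n * (1 + 2 * a))   ≡⟨ cong (λ m → ν₂ (m * (1 + 2 * a))) (^-distribˡ-+-* 2 k (ν₂ n)) ⟨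
    ν₂ (2 ^ (k + ν₂ n) * (1 + 2 * a))     ≡⟨ ν₂-2^k*odd (k + ν₂ n) a ⟩
    k + ν₂ n                              ∎
    where open ≡-Reasoning

  2^-mono-∣ : ∀ {m n} → m ≤ n → 2 ^ m ∣ 2 ^ n
  2^-mono-∣ {m} {n} m≤n = divides (2 ^ (n ∸ m)) (begin
    2 ^ n               ≡⟨ cong (2 ^_) (m+[n∸m]≡n m≤n) ⟨
    2 ^ (m + (n ∸ m))   ≡⟨ ^-distribˡ-+-* 2 m (n ∸ m) ⟩
    2 ^ m * 2 ^ (n ∸ m) ≡⟨ *-comm (2 ^ m) _ ⟩
    2 ^ (n ∸ m) * 2 ^ m ∎)
    where open ≡-Reasoning

  ≤ν₂⇒2^∣ : ∀ {M n} → 0 < n → M ≤ ν₂ n → 2 ^ M ∣ n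
  ≤ν₂⇒2^∣ {M} {n} 0<n M≤ν with ν₂-decomposition n 0<n
  ... | a , n≡2^ν*odd =
    ∣-trans (2^-mono-∣ M≤ν) (divides (1 + 2 * a) (trans n≡2^ν*odd (*-comm (2 ^ ν₂ n) (1 + 2 * a))))

  2^∣⇒≤ν₂ : ∀ {M n} → 0 < n → 2 ^ M ∣ n → M ≤ ν₂ n
  2^∣⇒≤ν₂ {M} {n} 0<n 2^M∣n with M ≤? ν₂ n | ν₂-decomposition n 0<n
  ... | yes M≤ν | _ = M≤ν
  ... | no M≰ν | a , n≡2^ν*odd = ⊥-elim (2∤1 (∣m+n∣m⇒∣n 2∣2a+1 (divides a (*-comm 2 a))))
    where
    2^ν*2∣2^ν*odd : 2 ^ ν₂ n * 2 ∣ 2 ^ ν₂ n * (1 + 2 * a)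
    2^ν*2∣2^ν*odd = subst₂ _∣_ (*-comm 2 (2 ^ ν₂ n)) n≡2^ν*odd (∣-trans (2^-mono-∣ (≰⇒> M≰ν)) 2^M∣n)
    2∣2a+1 : 2 ∣ 2 * a + 1
    2∣2a+1 = subst (2 ∣_) (+-comm 1 (2 * a)) (*-cancelˡ-∣ (2 ^ ν₂ n) {{m^n≢0 2 (ν₂ n)}} 2^ν*2∣2^ν*odd)
    2∤1 : ¬ 2 ∣ 1
    2∤1 2∣1 with ∣1⇒≡1 2∣1
    ... | ()

module TwoAdic where
  open import Data.Nat
  open import Data.Nat.Properties
  open import Data.Bool using (Bool; true; false)
  open import Data.Product using (_,_)
  open import Relation.Binary.PropositionalEquality
  open import Data.Nat.Tactic.RingSolver using (solve-∀)

  bit≤1 : ∀ b → bit b ≤ 1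
  bit≤1 true = ≤-refl
  bit≤1 false = z≤n

  bit-injective : ∀ {a b} → bit a ≡ bit b → a ≡ b
  bit-injective {true} {true} _ = refl
  bit-injective {false} {false} _ = refl

  trunc<2^ : ∀ ζ k → trunc ζ k < 2 ^ k
  trunc<2^ ζ zero = z<s
  trunc<2^ ζ (suc k) = begin-strict
    trunc ζ k + bit (ζ k) * 2 ^ k <⟨ +-mono-<-≤ (trunc<2^ ζ k) (*-monoˡ-≤ (2 ^ k) (bit≤1 (ζ k))) ⟩
    2 ^ k + 1 * 2 ^ k             ≡⟨⟩
    2 * 2 ^ k                     ∎
    where open ≤-Reasoning

  trunc-injective : ∀ ζ ζ′ → (∀ k → trunc ζ k ≡ trunc ζ′ k) → ∀ j → ζ j ≡ ζ′ j
  trunc-injective ζ ζ′ trunc≡ j = bit-injective (*-cancelʳ-≡ (bit (ζ j)) (bit (ζ′ j)) (2 ^ j) {{m^n≢0 2 j}}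
    (+-cancelˡ-≡ (trunc ζ j) _ _ (trans (trunc≡ (suc j)) (cong (_+ bit (ζ′ j) * 2 ^ j) (sym (trunc≡ j))))))

  limit-unique : ∀ {i ζ ζ′} → ConvergesTo₂ i ζ → ConvergesTo₂ i ζ′ → ∀ j → ζ j ≡ ζ′ j
  limit-unique {i} {ζ} {ζ′} i→ζ i→ζ′ = trunc-injective ζ ζ′ trunc≡
    where
    trunc≡ : ∀ k → trunc ζ k ≡ trunc ζ′ k
    trunc≡ k with i→ζ k | i→ζ′ k
    ... | N , ζ-from-N | N′ , ζ′-from-N′ =
      trans (sym (ζ-from-N (N + N′) (m≤m+n N N′))) (ζ′-from-N′ (N + N′) (m≤n+m N′ N))

  infixr 5 _∷₂_
  _∷₂_ : Bool → ℤ₂ → ℤ₂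
  (b ∷₂ ζ) zero = b
  (b ∷₂ ζ) (suc k) = ζ k

  trunc-∷ : ∀ b ζ k → trunc (b ∷₂ ζ) (suc k) ≡ bit b + 2 * trunc ζ k
  trunc-∷ true ζ zero = refl
  trunc-∷ false ζ zero = refl
  trunc-∷ b ζ (suc k) = begin
    trunc (b ∷₂ ζ) (suc k) + bit (ζ k) * 2 ^ suc k ≡⟨ cong (_+ bit (ζ k) * 2 ^ suc k) (trunc-∷ b ζ k) ⟩
    bit b + 2 * trunc ζ k + bit (ζ k) * (2 * 2 ^ k) ≡⟨ regroup (bit b) (trunc ζ k) (bit (ζ k)) (2 ^ k) ⟩
    bit b + 2 * (trunc ζ k + bit (ζ k) * 2 ^ k)     ∎
    where
    open ≡-Reasoning
    regroup : ∀ b t d h → b + 2 * t + d * (2 * h) ≡ b + 2 * (t + d * h)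
    regroup = solve-∀

module LinearRecurrence where
  open import Data.Integer
  open import Data.Integer.Tactic.RingSolver using (solve-∀; solve)
  open import Data.List using (_∷_; [])
  import Data.Nat as ℕ
  import Data.Nat.Tactic.RingSolver as ℕ-Ring
  open ℕ using (ℕ)
  import Data.Nat.Properties as ℕ
  open import Data.Integer.Properties using (pos-*; pos-+; +-identityʳ; +-inverseʳ; +-minus-telescope)
  open import Data.Product using (_×_; _,_; ∃-syntax)
  open import Data.Sum using (inj₁; inj₂)
  open import Relation.Binary.PropositionalEquality
  open Congruence

  -- e₁, e₂, e₃ are the elementary symmetric functions of the characteristic roots; doubling the
  -- step squares the roots (Recurrence-double).
  record Recurrence (F : ℕ → ℤ) (h : ℕ) (e₁ e₂ e₃ : ℤ) : Set where
    field at : ∀ p → F (3 ℕ.* h ℕ.+ p) ≡ e₁ * F (2 ℕ.* h ℕ.+ p) - e₂ * F (h ℕ.+ p) + e₃ * F p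
  open Recurrence public

  doubling-identity : ∀ e₁ e₂ e₃ v₀ v₁ v₂ v₃ v₄ v₅ v₆ →
    v₃ ≡ e₁ * v₂ - e₂ * v₁ + e₃ * v₀ →
    v₄ ≡ e₁ * v₃ - e₂ * v₂ + e₃ * v₁ →
    v₅ ≡ e₁ * v₄ - e₂ * v₃ + e₃ * v₂ →
    v₆ ≡ e₁ * v₅ - e₂ * v₄ + e₃ * v₃ →
    v₆ ≡ (e₁ * e₁ - + 2 * e₂) * v₄ - (e₂ * e₂ - + 2 * e₁ * e₃) * v₂ + (e₃ * e₃) * v₀
  doubling-identity e₁ e₂ e₃ v₀ v₁ v₂ _ _ _ _ refl refl refl refl =
    solve (e₁ ∷ e₂ ∷ e₃ ∷ v₀ ∷ v₁ ∷ v₂ ∷ [])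

  Recurrence-double : ∀ {F h e₁ e₂ e₃} → Recurrence F h e₁ e₂ e₃ →
    Recurrence F (2 ℕ.* h) (e₁ * e₁ - + 2 * e₂) (e₂ * e₂ - + 2 * e₁ * e₃) (e₃ * e₃)
  Recurrence-double {F} {h} {e₁} {e₂} {e₃} rec .at p =
    subst₂ (λ i j → F i ≡ (e₁ * e₁ - + 2 * e₂) * F j - (e₂ * e₂ - + 2 * e₁ * e₃) * v 2 + (e₃ * e₃) * v 0)
      (sym (reindex 3 p h)) (sym (reindex 2 p h))
      (doubling-identity e₁ e₂ e₃ (v 0) (v 1) (v 2) (v 3) (v 4) (v 5) (v 6) (v-rec 0) (v-rec 1) (v-rec 2) (v-rec 3))
    where
    v : ℕ → ℤ
    v k = F (k ℕ.* h ℕ.+ p)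
    reindex : ∀ k p h → k ℕ.* (2 ℕ.* h) ℕ.+ p ≡ (2 ℕ.* k) ℕ.* h ℕ.+ p
    reindex = ℕ-Ring.solve-∀
    shift : ∀ j k p h → (j ℕ.+ k) ℕ.* h ℕ.+ p ≡ j ℕ.* h ℕ.+ (k ℕ.* h ℕ.+ p)
    shift = ℕ-Ring.solve-∀
    shift₁ : ∀ k p h → (1 ℕ.+ k) ℕ.* h ℕ.+ p ≡ h ℕ.+ (k ℕ.* h ℕ.+ p)
    shift₁ = ℕ-Ring.solve-∀
    v-rec : ∀ k → v (3 ℕ.+ k) ≡ e₁ * v (2 ℕ.+ k) - e₂ * v (1 ℕ.+ k) + e₃ * v k
    v-rec k =
      subst₂ (λ i j → F i ≡ e₁ * F j - e₂ * v (1 ℕ.+ k) + e₃ * v k) (sym (shift 3 k p h)) (sym (shift 2 k p h))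
        (subst (λ i → F (3 ℕ.* h ℕ.+ q) ≡ e₁ * F (2 ℕ.* h ℕ.+ q) - e₂ * F i + e₃ * F q)
               (sym (shift₁ k p h)) (rec .at q))
      where q = k ℕ.* h ℕ.+ p

  Recurrence-cong : ∀ {F F′ h e₁ e₂ e₃} → (∀ p → F p ≡ F′ p) →
    Recurrence F h e₁ e₂ e₃ → Recurrence F′ h e₁ e₂ e₃
  Recurrence-cong {F} {F′} {h} {e₁} {e₂} {e₃} F≗F′ rec .at p = begin
    F′ (3 ℕ.* h ℕ.+ p)                                        ≡⟨ F≗F′ _ ⟨
    F (3 ℕ.* h ℕ.+ p)                                         ≡⟨ rec .at p ⟩
    e₁ * F (2 ℕ.* h ℕ.+ p) - e₂ * F (h ℕ.+ p) + e₃ * F p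
      ≡⟨ cong₂ (λ x y → e₁ * x - e₂ * y + e₃ * F p) (F≗F′ _) (F≗F′ _) ⟩
    e₁ * F′ (2 ℕ.* h ℕ.+ p) - e₂ * F′ (h ℕ.+ p) + e₃ * F p
      ≡⟨ cong (λ x → e₁ * F′ (2 ℕ.* h ℕ.+ p) - e₂ * F′ (h ℕ.+ p) + e₃ * x) (F≗F′ p) ⟩
    e₁ * F′ (2 ℕ.* h ℕ.+ p) - e₂ * F′ (h ℕ.+ p) + e₃ * F′ p  ∎
    where open ≡-Reasoning

  Recurrence-affine : ∀ {F h e₁ e₂ e₃} c a → Recurrence F (a ℕ.* h) e₁ e₂ e₃ →
    Recurrence (λ p → F (c ℕ.+ a ℕ.* p)) h e₁ e₂ e₃
  Recurrence-affine {F} {h} {e₁} {e₂} {e₃} c a rec .at p =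
    subst₂ (λ i j → F i ≡ e₁ * F j - e₂ * F (c ℕ.+ a ℕ.* (h ℕ.+ p)) + e₃ * F q)
      (sym (affine c a p h 3)) (sym (affine c a p h 2))
      (subst (λ i → F (3 ℕ.* (a ℕ.* h) ℕ.+ q) ≡ e₁ * F (2 ℕ.* (a ℕ.* h) ℕ.+ q) - e₂ * F i + e₃ * F q)
        (sym (affine₁ c a p h)) (rec .at q))
    where
    q = c ℕ.+ a ℕ.* p
    affine : ∀ c a p h k → c ℕ.+ a ℕ.* (k ℕ.* h ℕ.+ p) ≡ k ℕ.* (a ℕ.* h) ℕ.+ (c ℕ.+ a ℕ.* p)
    affine = ℕ-Ring.solve-∀
    affine₁ : ∀ c a p h → c ℕ.+ a ℕ.* (h ℕ.+ p) ≡ a ℕ.* h ℕ.+ (c ℕ.+ a ℕ.* p)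
    affine₁ = ℕ-Ring.solve-∀

  -- The characteristic polynomial is X(X - 1)² modulo 4h.
  Admissible : ℕ → ℤ → ℤ → ℤ → Set
  Admissible h e₁ e₂ e₃ = e₁ ≡ + 2 mod 4 ℕ.* h × e₂ ≡ + 1 mod 4 ℕ.* h × e₃ ≡ 0ℤ mod 4 ℕ.* h

  Admissible-double : ∀ {h e₁ e₂ e₃} → Admissible h e₁ e₂ e₃ →
    Admissible (2 ℕ.* h) (e₁ * e₁ - + 2 * e₂) (e₂ * e₂ - + 2 * e₁ * e₃) (e₃ * e₃)
  Admissible-double {h} (e₁≡2 , e₂≡1 , e₃≡0)
    with ≡-mod-elim* 4 h e₁≡2 | ≡-mod-elim* 4 h e₂≡1 | ≡-mod-elim* 4 h e₃≡0
  ... | a , refl | b , refl | c , refl =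
    intro (+ 2 * a * a * H + + 2 * a - b) (identity₁ a b H) ,
    intro (b + + 2 * b * b * H - + 2 * c - + 4 * a * c * H) (identity₂ a b c H) ,
    intro (+ 2 * c * c * H) (identity₃ c H)
    where
    H = + h
    intro : ∀ {x y} q → x ≡ y + q * (+ 8 * H) → x ≡ y mod 4 ℕ.* (2 ℕ.* h)
    intro {x} {y} q x≡y+q*8h = subst (λ m → x ≡ y mod m) (8h≡4*2h h) (≡-mod-intro* 8 h q x≡y+q*8h)
      where
      8h≡4*2h : ∀ h → 8 ℕ.* h ≡ 4 ℕ.* (2 ℕ.* h)
      8h≡4*2h = ℕ-Ring.solve-∀
    identity₁ : ∀ a b H → (+ 2 + a * (+ 4 * H)) * (+ 2 + a * (+ 4 * H)) - + 2 * (+ 1 + b * (+ 4 * H))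
                         ≡ + 2 + (+ 2 * a * a * H + + 2 * a - b) * (+ 8 * H)
    identity₁ = solve-∀
    identity₂ : ∀ a b c H →
      (+ 1 + b * (+ 4 * H)) * (+ 1 + b * (+ 4 * H)) - + 2 * (+ 2 + a * (+ 4 * H)) * (0ℤ + c * (+ 4 * H))
                         ≡ + 1 + (b + + 2 * b * b * H - + 2 * c - + 4 * a * c * H) * (+ 8 * H)
    identity₂ = solve-∀
    identity₃ : ∀ c H → (0ℤ + c * (+ 4 * H)) * (0ℤ + c * (+ 4 * H)) ≡ 0ℤ + (+ 2 * c * c * H) * (+ 8 * H)
    identity₃ = solve-∀

  second-difference : ∀ {F h e₁ e₂ e₃} → Recurrence F h e₁ e₂ e₃ → Admissible h e₁ e₂ e₃ → ∀ p →
    F p ≡ 0ℤ mod 4 → F (h ℕ.+ p) ≡ 0ℤ mod 4 → F (2 ℕ.* h ℕ.+ p) ≡ 0ℤ mod 4 →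
    F (3 ℕ.* h ℕ.+ p) - F (2 ℕ.* h ℕ.+ p) ≡ F (2 ℕ.* h ℕ.+ p) - F (h ℕ.+ p) mod 16 ℕ.* h
  second-difference {F} {h} {e₁} {e₂} {e₃} rec (e₁≡2 , e₂≡1 , e₃≡0) p F₀≡0 F₁≡0 F₂≡0 = begin
    F₃ - F₂                            ≡⟨ cong (_- F₂) (rec .at p) ⟩
    e₁ * F₂ - e₂ * F₁ + e₃ * F₀ - F₂   ≡⟨ regroup e₁ e₂ e₃ F₀ F₁ F₂ ⟩
    (F₂ - F₁) + correction             ≈⟨ ≡-mod-+ˡ (F₂ - F₁) correction≡0 ⟩
    (F₂ - F₁) + 0ℤ                     ≡⟨ +-identityʳ (F₂ - F₁) ⟩
    F₂ - F₁                            ∎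
    where
    open ≡-mod-Reasoning (16 ℕ.* h)
    F₀ = F p
    F₁ = F (h ℕ.+ p)
    F₂ = F (2 ℕ.* h ℕ.+ p)
    F₃ = F (3 ℕ.* h ℕ.+ p)
    correction = (e₁ - + 2) * F₂ + (+ 1 - e₂) * F₁ + e₃ * F₀
    regroup : ∀ e₁ e₂ e₃ F₀ F₁ F₂ → e₁ * F₂ - e₂ * F₁ + e₃ * F₀ - F₂
                                  ≡ (F₂ - F₁) + ((e₁ - + 2) * F₂ + (+ 1 - e₂) * F₁ + e₃ * F₀)
    regroup = solve-∀
    correction≡0 : correction ≡ 0ℤ mod 16 ℕ.* h
    correction≡0 = subst (λ m → correction ≡ 0ℤ mod m) (4h*4≡16h h)
      (≡-mod-+ (≡-mod-+ (≡-mod-*-≡0 (≡-mod-difference e₁≡2) F₂≡0)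
                        (≡-mod-*-≡0 (≡-mod-difference (≡-mod-sym e₂≡1)) F₁≡0))
               (≡-mod-*-≡0 e₃≡0 F₀≡0))
      where
      4h*4≡16h : ∀ h → 4 ℕ.* h ℕ.* 4 ≡ 16 ℕ.* h
      4h*4≡16h = ℕ-Ring.solve-∀

  levels : ∀ {F e₁ e₂ e₃} → Recurrence F 1 e₁ e₂ e₃ → Admissible 1 e₁ e₂ e₃ →
    ∀ j → ∃[ f₁ ] ∃[ f₂ ] ∃[ f₃ ] Recurrence F (2 ℕ.^ j) f₁ f₂ f₃ × Admissible (2 ℕ.^ j) f₁ f₂ f₃
  levels rec adm ℕ.zero = _ , _ , _ , rec , adm
  levels {F} rec adm (ℕ.suc j) with levels rec adm j
  ... | f₁ , f₂ , f₃ , rec′ , adm′ =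
    _ , _ , _ , Recurrence-double rec′ , Admissible-double {2 ℕ.^ j} adm′

  module Lipschitz {F e₁ e₂ e₃} (rec : Recurrence F 1 e₁ e₂ e₃) (adm : Admissible 1 e₁ e₂ e₃)
                   (F≡0 : ∀ q → F q ≡ 0ℤ mod 4) (F-step : ∀ q → F (1 ℕ.+ q) - F q ≡ + 4 mod 8) where

    -- The second differences at step h vanish modulo 16h, so the first differences at step 2h are
    -- twice those at step h modulo 16h.
    step : ∀ j q → let h = 2 ℕ.^ j in F (2 ℕ.* h ℕ.+ q) - F (h ℕ.+ q) ≡ + (4 ℕ.* h) mod 8 ℕ.* h
    step ℕ.zero q = F-step (1 ℕ.+ q)
    step (ℕ.suc j) q with levels rec adm j
    ... | f₁ , f₂ , f₃ , rec′ , adm′ = ≡-mod-cast (16h≡8*2h h) (begin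
      F (2 ℕ.* (2 ℕ.* h) ℕ.+ q) - F (2 ℕ.* h ℕ.+ q)   ≡⟨ cong₂ (λ i k → F i - F k) (reindex₃ q h) (reindex₁ q h) ⟩
      F (3 ℕ.* h ℕ.+ b) - F (h ℕ.+ b)               ≡⟨ +-minus-telescope (F (3 ℕ.* h ℕ.+ b)) (F (2 ℕ.* h ℕ.+ b)) _ ⟨
      d₂ + d₁                                      ≈⟨ ≡-mod-+ (second-difference rec′ adm′ b
                                                                 (F≡0 b) (F≡0 (h ℕ.+ b)) (F≡0 (2 ℕ.* h ℕ.+ b)))
                                                              (≡-mod-reflexive {d₁} refl) ⟩
      d₁ + d₁                                      ≡⟨ x+x≡2x d₁ ⟩
      + 2 * d₁                                     ≈⟨ ≡-mod-cast (2*8h≡16h h) (≡-mod-scale 2 (step j b)) ⟩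
      + 2 * + (4 ℕ.* h)                            ≡⟨ trans (sym (pos-* 2 (4 ℕ.* h))) (cong +_ (2*4h≡4*2h h)) ⟩
      + (4 ℕ.* (2 ℕ.* h))                          ∎)
      where
      open ≡-mod-Reasoning (16 ℕ.* 2 ℕ.^ j)
      h = 2 ℕ.^ j
      b = h ℕ.+ q
      d₁ = F (2 ℕ.* h ℕ.+ b) - F (h ℕ.+ b)
      d₂ = F (3 ℕ.* h ℕ.+ b) - F (2 ℕ.* h ℕ.+ b)
      reindex₁ : ∀ q h → 2 ℕ.* h ℕ.+ q ≡ h ℕ.+ (h ℕ.+ q)
      reindex₁ = ℕ-Ring.solve-∀
      reindex₃ : ∀ q h → 2 ℕ.* (2 ℕ.* h) ℕ.+ q ≡ 3 ℕ.* h ℕ.+ (h ℕ.+ q)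
      reindex₃ = ℕ-Ring.solve-∀
      x+x≡2x : ∀ x → x + x ≡ + 2 * x
      x+x≡2x = solve-∀
      2*8h≡16h : ∀ h → 2 ℕ.* (8 ℕ.* h) ≡ 16 ℕ.* h
      2*8h≡16h = ℕ-Ring.solve-∀
      2*4h≡4*2h : ∀ h → 2 ℕ.* (4 ℕ.* h) ≡ 4 ℕ.* (2 ℕ.* h)
      2*4h≡4*2h = ℕ-Ring.solve-∀
      16h≡8*2h : ∀ h → 16 ℕ.* h ≡ 8 ℕ.* (2 ℕ.* h)
      16h≡8*2h = ℕ-Ring.solve-∀

    forward : ∀ j q n → let h = 2 ℕ.^ j in
      F (n ℕ.* h ℕ.+ (h ℕ.+ q)) - F (h ℕ.+ q) ≡ + (4 ℕ.* (n ℕ.* h)) mod 8 ℕ.* h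
    forward j q ℕ.zero = ≡-mod-reflexive (+-inverseʳ (F (2 ℕ.^ j ℕ.+ q)))
    forward j q (ℕ.suc n) = begin
      F ((1 ℕ.+ n) ℕ.* h ℕ.+ b) - F b
        ≡⟨ +-minus-telescope (F ((1 ℕ.+ n) ℕ.* h ℕ.+ b)) (F (n ℕ.* h ℕ.+ b)) (F b) ⟨
      (F ((1 ℕ.+ n) ℕ.* h ℕ.+ b) - F (n ℕ.* h ℕ.+ b)) + (F (n ℕ.* h ℕ.+ b) - F b)
        ≈⟨ ≡-mod-+ last-step (forward j q n) ⟩
      + (4 ℕ.* h) + + (4 ℕ.* (n ℕ.* h))
        ≡⟨ trans (sym (pos-+ (4 ℕ.* h) (4 ℕ.* (n ℕ.* h)))) (cong +_ (sym (ℕ.*-distribˡ-+ 4 h (n ℕ.* h)))) ⟩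
      + (4 ℕ.* ((1 ℕ.+ n) ℕ.* h)) ∎
      where
      open ≡-mod-Reasoning (8 ℕ.* 2 ℕ.^ j)
      h = 2 ℕ.^ j
      b = h ℕ.+ q
      reindex : ∀ q n h → 2 ℕ.* h ℕ.+ (n ℕ.* h ℕ.+ q) ≡ (1 ℕ.+ n) ℕ.* h ℕ.+ (h ℕ.+ q)
      reindex = ℕ-Ring.solve-∀
      reindex′ : ∀ q n h → h ℕ.+ (n ℕ.* h ℕ.+ q) ≡ n ℕ.* h ℕ.+ (h ℕ.+ q)
      reindex′ = ℕ-Ring.solve-∀
      last-step : F ((1 ℕ.+ n) ℕ.* h ℕ.+ b) - F (n ℕ.* h ℕ.+ b) ≡ + (4 ℕ.* h) mod 8 ℕ.* h
      last-step = subst₂ (λ i k → F i - F k ≡ + (4 ℕ.* h) mod 8 ℕ.* h) (reindex q n h) (reindex′ q n h)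
                    (step j (n ℕ.* h ℕ.+ q))

    lipschitz-ordered : ∀ j a b → b ℕ.≤ a → 2 ℕ.^ j ℕ.≤ b → + a ≡ + b mod 2 ℕ.^ j →
      F a - F b ≡ + 4 * (+ a - + b) mod 8 ℕ.* 2 ℕ.^ j
    lipschitz-ordered j a b b≤a h≤b a≡b with ≡-mod⇒offset a≡b b≤a
    ... | n , refl = begin
      F (b ℕ.+ n ℕ.* h) - F b                           ≡⟨ cong₂ (λ i k → F i - F k) reindex (sym h+[b-h]≡b) ⟩
      F (n ℕ.* h ℕ.+ (h ℕ.+ (b ℕ.∸ h))) - F (h ℕ.+ (b ℕ.∸ h)) ≈⟨ forward j (b ℕ.∸ h) n ⟩
      + (4 ℕ.* (n ℕ.* h))                               ≡⟨ pos-* 4 (n ℕ.* h) ⟩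
      + 4 * + (n ℕ.* h)
        ≡⟨ cong (+ 4 *_) (trans (cancel (+ b) (+ (n ℕ.* h))) (cong (_- + b) (sym (pos-+ b (n ℕ.* h))))) ⟩
      + 4 * (+ (b ℕ.+ n ℕ.* h) - + b)                   ∎
      where
      open ≡-mod-Reasoning (8 ℕ.* 2 ℕ.^ j)
      h = 2 ℕ.^ j
      h+[b-h]≡b : h ℕ.+ (b ℕ.∸ h) ≡ b
      h+[b-h]≡b = ℕ.m+[n∸m]≡n h≤b
      reindex : b ℕ.+ n ℕ.* h ≡ n ℕ.* h ℕ.+ (h ℕ.+ (b ℕ.∸ h))
      reindex = trans (ℕ.+-comm b (n ℕ.* h)) (cong (n ℕ.* h ℕ.+_) (sym h+[b-h]≡b))
      cancel : ∀ x y → y ≡ x + y - x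
      cancel = solve-∀

    lipschitz : ∀ j a b → 2 ℕ.^ j ℕ.≤ a → 2 ℕ.^ j ℕ.≤ b → + a ≡ + b mod 2 ℕ.^ j →
      F a - F b ≡ + 4 * (+ a - + b) mod 8 ℕ.* 2 ℕ.^ j
    lipschitz j a b h≤a h≤b a≡b with ℕ.≤-total b a
    ... | inj₁ b≤a = lipschitz-ordered j a b b≤a h≤b a≡b
    ... | inj₂ a≤b = subst₂ (λ x y → x ≡ y mod 8 ℕ.* 2 ℕ.^ j) (negate (F b) (F a)) (negate-* (+ b) (+ a))
                       (≡-mod-neg (lipschitz-ordered j b a a≤b h≤a (≡-mod-sym a≡b)))
      where
      negate : ∀ x y → - (x - y) ≡ y - x
      negate = solve-∀
      negate-* : ∀ x y → - (+ 4 * (x - y)) ≡ + 4 * (y - x)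
      negate-* = solve-∀

module Lifting where
  open import Data.Integer
  open import Data.Integer.Properties using (pos-*; pos-+; +-identityʳ)
  open import Data.Integer.Divisibility.Signed using (_∣?_; _∣_)
  open import Data.Integer.Tactic.RingSolver using (solve-∀)
  import Data.Nat as ℕ
  import Data.Nat.Properties as ℕP
  import Data.Nat.Tactic.RingSolver as ℕ-Ring
  open ℕ using (ℕ)
  open import Data.Bool using (Bool; not)
  open import Function.Bundles using (_⇔_; mk⇔; Equivalence)
  open import Relation.Nullary using (Dec; does; yes; no)
  open import Relation.Binary.PropositionalEquality
  import Data.Nat.Divisibility as ℕD
  open Congruence
  open TwoAdic using (trunc<2^)

  4*2^n≡2^[2+n] : ∀ n → 4 ℕ.* 2 ℕ.^ n ≡ 2 ℕ.^ (2 ℕ.+ n)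
  4*2^n≡2^[2+n] n = four (2 ℕ.^ n)
    where
    four : ∀ x → 4 ℕ.* x ≡ 2 ℕ.* (2 ℕ.* x)
    four = ℕ-Ring.solve-∀

  large-base : ∀ r c H → 1 ℕ.≤ H → H ℕ.+ c ℕ.≤ r ℕ.+ (1 ℕ.+ c) ℕ.* H
  large-base r c H 1≤H = begin
    H ℕ.+ c               ≤⟨ ℕP.+-monoʳ-≤ H (ℕP.m≤m*n c H) ⟩
    H ℕ.+ c ℕ.* H         ≤⟨ ℕP.m≤n+m _ r ⟩
    r ℕ.+ (1 ℕ.+ c) ℕ.* H ∎
    where
    open ℕP.≤-Reasoning
    instance _ = ℕ.>-nonZero 1≤H

  -- g is 2-adically affine of slope 4 above the threshold c, so its zero is found digit by digit.
  module Digits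
    (g : ℕ → ℤ) (c : ℕ)
    (g≡0 : ∀ p → c ℕ.< p → g p ≡ 0ℤ mod 4)
    (g-lipschitz : ∀ j a b → 2 ℕ.^ j ℕ.+ c ℕ.≤ a → 2 ℕ.^ j ℕ.+ c ℕ.≤ b → + a ≡ + b mod 2 ℕ.^ j →
                   g a - g b ≡ + 4 * (+ a - + b) mod 2 ℕ.^ (3 ℕ.+ j))
    where

    -- A representative of r modulo 2^(1+k) beyond all thresholds used at level 1 + k.
    base : ℕ → ℕ → ℕ
    base k r = r ℕ.+ (1 ℕ.+ c) ℕ.* 2 ℕ.^ (1 ℕ.+ k)

    digit : ℕ → ℕ → Bool
    digit k r = not (does (+ 2 ℕ.^ (3 ℕ.+ k) ∣? g (base k r)))

    ρ : ℕ → ℕ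
    ρ ℕ.zero = 0
    ρ (ℕ.suc k) = ρ k ℕ.+ bit (digit k (ρ k)) ℕ.* 2 ℕ.^ k

    ξ : ℤ₂
    ξ k = digit k (ρ k)

    trunc-ξ : ∀ k → trunc ξ k ≡ ρ k
    trunc-ξ ℕ.zero = refl
    trunc-ξ (ℕ.suc k) = cong (ℕ._+ bit (ξ k) ℕ.* 2 ℕ.^ k) (trunc-ξ k)

    ρ<2^ : ∀ k → ρ k ℕ.< 2 ℕ.^ k
    ρ<2^ k = subst (ℕ._< 2 ℕ.^ k) (trunc-ξ k) (trunc<2^ ξ k)

    module Step (k : ℕ)
      (ih : ∀ p → 2 ℕ.^ k ℕ.+ c ℕ.≤ p → (g p ≡ 0ℤ mod 2 ℕ.^ (2 ℕ.+ k) ⇔ + p ≡ + ρ k mod 2 ℕ.^ k))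
      where
      h = 2 ℕ.^ k
      H = 2 ℕ.^ (1 ℕ.+ k)
      r = ρ k
      s = base k r
      s′ = s ℕ.+ bit (digit k r) ℕ.* h

      s-large : H ℕ.+ c ℕ.≤ s
      s-large = large-base r c H (ℕP.m^n>0 2 (1 ℕ.+ k))

      h∣H : h ℕD.∣ H
      h∣H = ℕD.n∣m*n 2

      s≡r : + s ≡ + r mod h
      s≡r = ≡-mod-weaken h∣H (offset⇒≡-mod r (1 ℕ.+ c) H)

      s′≡ρ : + s′ ≡ + ρ (1 ℕ.+ k) mod H
      s′≡ρ = subst (λ z → + z ≡ + ρ (1 ℕ.+ k) mod H) (swap r _ _) (offset⇒≡-mod (ρ (1 ℕ.+ k)) (1 ℕ.+ c) H)
        where
        swap : ∀ r x y → r ℕ.+ x ℕ.+ y ≡ r ℕ.+ y ℕ.+ x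
        swap = ℕ-Ring.solve-∀

      ρ≡r : + ρ (1 ℕ.+ k) ≡ + r mod h
      ρ≡r = offset⇒≡-mod r (bit (digit k r)) h

      h+c≤s : h ℕ.+ c ℕ.≤ s
      h+c≤s = ℕP.≤-trans (ℕP.+-monoˡ-≤ c (ℕP.m≤n*m h 2)) s-large

      g-s≡0 : g s ≡ 0ℤ mod 2 ℕ.^ (2 ℕ.+ k)
      g-s≡0 = Equivalence.from (ih s h+c≤s) s≡r

      g-step : g (s ℕ.+ 1 ℕ.* h) - g s ≡ + 2 ℕ.^ (2 ℕ.+ k) mod 2 ℕ.^ (3 ℕ.+ k)
      g-step = ≡-mod-trans
        (g-lipschitz k (s ℕ.+ 1 ℕ.* h) s (ℕP.≤-trans h+c≤s (ℕP.m≤m+n s _)) h+c≤s (offset⇒≡-mod s 1 h))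
        (≡-mod-reflexive 4h≡m)
        where
        open ≡-Reasoning
        cancel : ∀ x y → + 4 * (x + y - x) ≡ + 4 * y
        cancel = solve-∀
        four : ∀ h → 4 ℕ.* (1 ℕ.* h) ≡ 2 ℕ.* (2 ℕ.* h)
        four = ℕ-Ring.solve-∀
        4h≡m : + 4 * (+ (s ℕ.+ 1 ℕ.* h) - + s) ≡ + 2 ℕ.^ (2 ℕ.+ k)
        4h≡m = begin
          + 4 * (+ (s ℕ.+ 1 ℕ.* h) - + s)   ≡⟨ cong (λ z → + 4 * (z - + s)) (pos-+ s (1 ℕ.* h)) ⟩
          + 4 * (+ s + + (1 ℕ.* h) - + s)   ≡⟨ cancel (+ s) (+ (1 ℕ.* h)) ⟩
          + 4 * + (1 ℕ.* h)                 ≡⟨ pos-* 4 (1 ℕ.* h) ⟨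
          + (4 ℕ.* (1 ℕ.* h))               ≡⟨ cong +_ (four h) ⟩
          + 2 ℕ.^ (2 ℕ.+ k)                 ∎

      g-lift : (d : Dec (+ 2 ℕ.^ (3 ℕ.+ k) ∣ g s)) →
        g (s ℕ.+ bit (not (does d)) ℕ.* h) ≡ 0ℤ mod 2 ℕ.^ (3 ℕ.+ k)
      g-lift (yes 8h∣gs) = subst (λ z → g z ≡ 0ℤ mod 2 ℕ.^ (3 ℕ.+ k)) (sym (ℕP.+-identityʳ s))
                                 (mod-intro (subst (_ ∣_) (sym (+-identityʳ (g s))) 8h∣gs))
      g-lift (no ¬8h∣gs) = begin
        g (s ℕ.+ 1 ℕ.* h)                   ≡⟨ split (g (s ℕ.+ 1 ℕ.* h)) (g s) ⟩
        (g (s ℕ.+ 1 ℕ.* h) - g s) + g s     ≈⟨ ≡-mod-+ g-step gs≡m ⟩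
        + m + + m                           ≈⟨ ≡-mod-twice-self m ⟩
        0ℤ                                  ∎
        where
        open ≡-mod-Reasoning (2 ℕ.^ (3 ℕ.+ k))
        m = 2 ℕ.^ (2 ℕ.+ k)
        split : ∀ x y → x ≡ (x - y) + y
        split = solve-∀
        gs≡m : g s ≡ + m mod 2 ℕ.^ (3 ℕ.+ k)
        gs≡m = half-residue g-s≡0 (λ gs≡0 → ¬8h∣gs (subst (_ ∣_) (+-identityʳ (g s)) (∣-difference gs≡0)))

      g-s′≡0 : g s′ ≡ 0ℤ mod 2 ℕ.^ (3 ℕ.+ k)
      g-s′≡0 = g-lift (+ 2 ℕ.^ (3 ℕ.+ k) ∣? g s)

      H+c≤s′ : H ℕ.+ c ℕ.≤ s′
      H+c≤s′ = ℕP.≤-trans s-large (ℕP.m≤m+n s _)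

      4x≡0⇒x≡0 : ∀ {x} → + 4 * x ≡ 0ℤ mod 2 ℕ.^ (3 ℕ.+ k) → x ≡ 0ℤ mod H
      4x≡0⇒x≡0 {x} 4x≡0 = ≡-mod-cancel 4 (≡-mod-cast (sym (4*2^n≡2^[2+n] (1 ℕ.+ k))) 4x≡0)

      x≡0⇒4x≡0 : ∀ {x} → x ≡ 0ℤ mod H → + 4 * x ≡ 0ℤ mod 2 ℕ.^ (3 ℕ.+ k)
      x≡0⇒4x≡0 {x} x≡0 = ≡-mod-cast (4*2^n≡2^[2+n] (1 ℕ.+ k)) (≡-mod-scale 4 x≡0)

      vanishing⇒residue : ∀ p → H ℕ.+ c ℕ.≤ p →
        g p ≡ 0ℤ mod 2 ℕ.^ (3 ℕ.+ k) → + p ≡ + ρ (1 ℕ.+ k) mod H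
      vanishing⇒residue p H+c≤p gp≡0 = ≡-mod-trans (≡-mod-from-difference (4x≡0⇒x≡0 4[p-s′]≡0)) s′≡ρ
        where
        h+c≤p : h ℕ.+ c ℕ.≤ p
        h+c≤p = ℕP.≤-trans (ℕP.+-monoˡ-≤ c (ℕP.m≤n*m h 2)) H+c≤p
        p≡s′ : + p ≡ + s′ mod h
        p≡s′ = ≡-mod-trans (Equivalence.to (ih p h+c≤p) (≡-mod-weaken (ℕD.n∣m*n 2) gp≡0))
                           (≡-mod-sym (≡-mod-trans (≡-mod-weaken h∣H s′≡ρ) ρ≡r))
        4[p-s′]≡0 : + 4 * (+ p - + s′) ≡ 0ℤ mod 2 ℕ.^ (3 ℕ.+ k)
        4[p-s′]≡0 = ≡-mod-trans (≡-mod-sym (g-lipschitz k p s′ h+c≤p (ℕP.≤-trans h+c≤s (ℕP.m≤m+n s _)) p≡s′))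
                                (≡-mod-+ gp≡0 (≡-mod-neg g-s′≡0))

      residue⇒vanishing : ∀ p → H ℕ.+ c ℕ.≤ p →
        + p ≡ + ρ (1 ℕ.+ k) mod H → g p ≡ 0ℤ mod 2 ℕ.^ (3 ℕ.+ k)
      residue⇒vanishing p H+c≤p p≡ρ = ≡-mod-trans (≡-mod-from-difference gp-gs′≡0) g-s′≡0
        where
        p≡s′ : + p ≡ + s′ mod H
        p≡s′ = ≡-mod-trans p≡ρ (≡-mod-sym s′≡ρ)
        gp-gs′≡0 : g p - g s′ ≡ 0ℤ mod 2 ℕ.^ (3 ℕ.+ k)
        gp-gs′≡0 = ≡-mod-trans (≡-mod-weaken (ℕD.n∣m*n 2) (g-lipschitz (1 ℕ.+ k) p s′ H+c≤p H+c≤s′ p≡s′))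
                               (x≡0⇒4x≡0 (≡-mod-difference p≡s′))

    vanishing⇔residue : ∀ k p → 2 ℕ.^ k ℕ.+ c ℕ.≤ p →
      (g p ≡ 0ℤ mod 2 ℕ.^ (2 ℕ.+ k) ⇔ + p ≡ + ρ k mod 2 ℕ.^ k)
    vanishing⇔residue ℕ.zero p 1+c≤p = mk⇔ (λ _ → ≡-mod-1) (λ _ → g≡0 p 1+c≤p)
    vanishing⇔residue (ℕ.suc k) p H+c≤p = mk⇔ (vanishing⇒residue p H+c≤p) (residue⇒vanishing p H+c≤p)
      where open Step k (vanishing⇔residue k)

module Sequence where
  open import Data.Nat
  open import Data.Nat.Properties
  open import Data.Product using (_×_; _,_; proj₁; proj₂; ∃-syntax)
  open import Data.Sum using (_⊎_; inj₁; inj₂)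
  open import Data.Empty using (⊥-elim)
  open import Function using (_∘_)
  open import Relation.Nullary using (¬_)
  open import Relation.Binary.PropositionalEquality
  open import Data.Nat.Tactic.RingSolver using (solve-∀; solve)
  open import Data.List using (_∷_; [])

  U-rec : ∀ i → U (3 + i) ≡ 12 * U (2 + i) + 6 * U (1 + i) + 12 * U i
  U-rec i = refl

  -- scaled m = (U(1+2m) / 2^m , U(2+2m) / 2^m , U(3+2m) / 2^(1+m)), and step is the recurrence of U
  -- rewritten for these rescaled terms.
  step : ℕ × ℕ × ℕ → ℕ × ℕ × ℕ
  step (a , b , c) = let b′ = 12 * c + 3 * b + 6 * a in c , b′ , 6 * b′ + 3 * c + 3 * b

  scaled : ℕ → ℕ × ℕ × ℕ
  scaled zero = 13 , 163 , 1023
  scaled (suc m) = step (scaled m)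

  Y Z : ℕ → ℕ
  Y m = proj₁ (scaled m)
  Z m = proj₁ (proj₂ (scaled m))

  U≡2^m*scaled : ∀ m → U (1 + 2 * m) ≡ 2 ^ m * Y m × U (2 + 2 * m) ≡ 2 ^ m * Z m
                                                 × U (3 + 2 * m) ≡ 2 ^ suc m * Y (suc m)
  U≡2^m*scaled zero = refl , refl , refl
  U≡2^m*scaled (suc m) with U≡2^m*scaled m
  ... | U₁ , U₂ , U₃ = U₁′ , U₂′ , U₃′
    where
    P = 2 ^ m
    2*suc : 2 * suc m ≡ 2 + 2 * m
    2*suc = solve (m ∷ [])
    combine₁ : ∀ {u₁ u₂ u₃} P a b c → u₁ ≡ P * a → u₂ ≡ P * b → u₃ ≡ 2 * P * c →
      12 * u₃ + 6 * u₂ + 12 * u₁ ≡ 2 * P * (12 * c + 3 * b + 6 * a)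
    combine₁ P a b c refl refl refl = solve (P ∷ a ∷ b ∷ c ∷ [])
    U₁′ : U (1 + 2 * suc m) ≡ 2 ^ suc m * Y (suc m)
    U₁′ = trans (cong (λ i → U (1 + i)) 2*suc) U₃
    U₂′ : U (2 + 2 * suc m) ≡ 2 ^ suc m * Z (suc m)
    U₂′ = trans (cong (λ i → U (2 + i)) 2*suc)
                (trans (U-rec (1 + 2 * m)) (combine₁ P (Y m) (Z m) (Y (suc m)) U₁ U₂ U₃))
    U₃′ : U (3 + 2 * suc m) ≡ 2 ^ suc (suc m) * Y (suc (suc m))
    U₃′ = trans (cong (λ i → U (3 + i)) 2*suc)
                (trans (U-rec (2 + 2 * m)) (combine₂ P (Z m) (Y (suc m)) (Z (suc m)) U₂ U₃ U₄))
      where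
      U₄ : U (4 + 2 * m) ≡ 2 * P * Z (suc m)
      U₄ = trans (cong (λ i → U (2 + i)) (sym 2*suc)) U₂′
      combine₂ : ∀ {u₂ u₃ u₄} P b c z → u₂ ≡ P * b → u₃ ≡ 2 * P * c → u₄ ≡ 2 * P * z →
        12 * u₄ + 6 * u₃ + 12 * u₂ ≡ 2 * (2 * P) * (6 * z + 3 * c + 3 * b)
      combine₂ P b c z refl refl refl = solve (P ∷ b ∷ c ∷ z ∷ [])

  Y-rec : ∀ m → Y (3 + m) ≡ 78 * Y (2 + m) + 63 * Y (1 + m) + 18 * Y m
  Y-rec m = cayley-hamilton (Y m) (Z m) (Y (1 + m))
    where
    cayley-hamilton : ∀ a b c →
      let z₁ = 12 * c + 3 * b + 6 * a ; y₂ = 6 * z₁ + 3 * c + 3 * b ; z₂ = 12 * y₂ + 3 * z₁ + 6 * c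
      in 6 * z₂ + 3 * y₂ + 3 * z₁ ≡ 78 * y₂ + 63 * c + 18 * a
    cayley-hamilton = solve-∀

  Odd Even : ℕ → Set
  Odd n = ∃[ a ] n ≡ 1 + 2 * a
  Even n = ∃[ a ] n ≡ 2 * a

  Z-odd : ∀ m → Odd (Z m)
  Z-odd zero = 81 , refl
  Z-odd (suc m) with Z-odd m
  ... | a , Zm≡1+2a = 6 * Y (suc m) + 1 + 3 * a + 3 * Y m , combine (Y (suc m)) (Y m) a Zm≡1+2a
    where
    combine : ∀ {z} y′ y a → z ≡ 1 + 2 * a → 12 * y′ + 3 * z + 6 * y ≡ 1 + 2 * (6 * y′ + 1 + 3 * a + 3 * y)
    combine y′ y a refl = solve (y′ ∷ y ∷ a ∷ [])

  Y-odd⇒even : ∀ m → Odd (Y (suc m)) → Even (Y (suc (suc m)))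
  Y-odd⇒even m (c , Y′≡1+2c) with Z-odd m
  ... | b , Z≡1+2b = 3 * Z (suc m) + 3 + 3 * c + 3 * b , combine (Z (suc m)) c b Y′≡1+2c Z≡1+2b
    where
    combine : ∀ {y z} z′ c b → y ≡ 1 + 2 * c → z ≡ 1 + 2 * b →
      6 * z′ + 3 * y + 3 * z ≡ 2 * (3 * z′ + 3 + 3 * c + 3 * b)
    combine z′ c b refl refl = solve (z′ ∷ c ∷ b ∷ [])

  Y-even⇒odd : ∀ m → Even (Y (suc m)) → Odd (Y (suc (suc m)))
  Y-even⇒odd m (c , Y′≡2c) with Z-odd m
  ... | b , Z≡1+2b = 3 * Z (suc m) + 3 * c + 1 + 3 * b , combine (Z (suc m)) c b Y′≡2c Z≡1+2b
    where
    combine : ∀ {y z} z′ c b → y ≡ 2 * c → z ≡ 1 + 2 * b →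
      6 * z′ + 3 * y + 3 * z ≡ 1 + 2 * (3 * z′ + 3 * c + 1 + 3 * b)
    combine z′ c b refl refl = solve (z′ ∷ c ∷ b ∷ [])

  Y-odd : ∀ p → Odd (Y (1 + 2 * p))
  Y-odd zero = 511 , refl
  Y-odd (suc p) = subst (λ i → Odd (Y (1 + i))) (sym 2*suc) (Y-even⇒odd (1 + 2 * p) (Y-odd⇒even (2 * p) (Y-odd p)))
    where
    2*suc : 2 * suc p ≡ 2 + 2 * p
    2*suc = solve (p ∷ [])

  Y-step : ∀ m → Y m ≤ Y (suc m)
  Y-step zero = m≤m+n 13 1010
  Y-step (suc m) = begin
    Y (suc m)                                   ≤⟨ m≤n*m (Y (suc m)) 3 ⟩
    3 * Y (suc m)                               ≤⟨ m≤n+m _ (6 * Z (suc m)) ⟩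
    6 * Z (suc m) + 3 * Y (suc m)               ≤⟨ m≤m+n _ (3 * Z m) ⟩
    6 * Z (suc m) + 3 * Y (suc m) + 3 * Z m     ∎
    where open ≤-Reasoning

  Y-mono : ∀ {m n} → m ≤ n → Y m ≤ Y n
  Y-mono {n = zero} z≤n = ≤-refl
  Y-mono {m} {suc n} m≤1+n with m≤n⇒m<n∨m≡n m≤1+n
  ... | inj₁ m<1+n = ≤-trans (Y-mono (≤-pred m<1+n)) (Y-step n)
  ... | inj₂ refl = ≤-refl

  Y>0 : ∀ m → 0 < Y m
  Y>0 m = <-≤-trans z<s (Y-mono {0} {m} z≤n)

  -- Opaque, as is F below: unfolding Y at large indices makes conversion checking blow up.
  opaque
    G : ℕ → ℕ
    G p = Y (2 * p)

    G-definition : ∀ p → G p ≡ Y (2 * p)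
    G-definition p = refl

  G>0 : ∀ p → 0 < G p
  G>0 p = subst (0 <_) (sym (G-definition p)) (Y>0 (2 * p))

  G-mono : ∀ {p q} → p ≤ q → G p ≤ G q
  G-mono {p} {q} p≤q = subst₂ _≤_ (sym (G-definition p)) (sym (G-definition q)) (Y-mono (*-monoʳ-≤ 2 p≤q))

  open Valuation using (ν₂-2^k*odd; ν₂-2^k*)

  ν₂-U-even : ∀ m → ν₂ (U (2 + 2 * m)) ≡ m
  ν₂-U-even m with U≡2^m*scaled m | Z-odd m
  ... | _ , U₂ , _ | a , Z≡1+2a = trans (cong ν₂ (trans U₂ (cong (2 ^ m *_) Z≡1+2a))) (ν₂-2^k*odd m a)

  ν₂-U-3mod4 : ∀ p → ν₂ (U (3 + 2 * (2 * p))) ≡ 1 + 2 * p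
  ν₂-U-3mod4 p with U≡2^m*scaled (2 * p) | Y-odd p
  ... | _ , _ , U₃ | a , Y≡1+2a =
    trans (cong ν₂ (trans U₃ (cong (2 ^ suc (2 * p) *_) Y≡1+2a))) (ν₂-2^k*odd (1 + 2 * p) a)

  ν₂-U-1mod4 : ∀ p → ν₂ (U (1 + 2 * (2 * p))) ≡ 2 * p + ν₂ (G p)
  ν₂-U-1mod4 p with U≡2^m*scaled (2 * p)
  ... | U₁ , _ , _ = trans (cong ν₂ (trans U₁ (cong (2 ^ (2 * p) *_) (sym (G-definition p)))))
                          (ν₂-2^k* (2 * p) (G p) (G>0 p))

  even-or-odd : ∀ n → (∃[ m ] n ≡ 2 * m) ⊎ (∃[ m ] n ≡ 1 + 2 * m)
  even-or-odd zero = inj₁ (0 , refl)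
  even-or-odd (suc n) with even-or-odd n
  ... | inj₁ (m , refl) = inj₂ (m , refl)
  ... | inj₂ (m , refl) = inj₁ (suc m , solve (m ∷ []))

  no-gap : ∀ i ν M → 2 * ν ≤ i → ¬ (i + 2 * suc M ≤ 2 * ν)
  no-gap i ν M 2ν≤i gap = <⇒≱ (m<m+n i z<s) (≤-trans gap 2ν≤i)

  gap⇒ν₂G : ∀ a M ν → 1 + 2 * a + 2 * suc M ≤ 2 * (a + ν) → 2 + M ≤ ν
  gap⇒ν₂G a M ν gap =
    *-cancelˡ-< 2 (suc M) ν (+-cancelˡ-≤ (2 * a) _ _ (subst₂ _≤_ (regroup a M) (*-distribˡ-+ 2 a ν) gap))
    where
    regroup : ∀ a M → 1 + 2 * a + 2 * suc M ≡ 2 * a + suc (2 * suc M)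
    regroup = solve-∀

  ν₂G⇒gap : ∀ a M ν → 2 + M ≤ ν → 1 + 2 * a + 2 * suc M ≤ 2 * (a + ν)
  ν₂G⇒gap a M ν 2+M≤ν = subst₂ _≤_ (regroup a M) (sym (*-distribˡ-+ 2 a ν))
    (+-monoʳ-≤ (2 * a) (≤-trans (≤-trans (n≤1+n _) (≤-reflexive (twice M))) (*-monoʳ-≤ 2 2+M≤ν)))
    where
    twice : ∀ M → suc (suc (2 * suc M)) ≡ 2 * (2 + M)
    twice = solve-∀
    regroup : ∀ a M → 2 * a + suc (2 * suc M) ≡ 1 + 2 * a + 2 * suc M
    regroup = solve-∀

  gap⇒1mod4 : ∀ i M → i + 2 * suc M ≤ 2 * ν₂ (U i) → ∃[ p ] i ≡ 1 + 2 * (2 * p) × 2 + M ≤ ν₂ (G p)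
  gap⇒1mod4 i M gap with even-or-odd i
  ... | inj₁ (zero , refl) = ⊥-elim (no-gap 0 0 M z≤n gap)
  ... | inj₁ (suc m , refl) = ⊥-elim (no-gap (2 * suc m) m M (≤-trans (m≤n+m (2 * m) 2) (≤-reflexive (sym 2*suc)))
                                        (subst (λ ν → 2 * suc m + 2 * suc M ≤ 2 * ν) (ν₂-U-even′) gap))
    where
    2*suc : 2 * suc m ≡ 2 + 2 * m
    2*suc = solve (m ∷ [])
    ν₂-U-even′ : ν₂ (U (2 * suc m)) ≡ m
    ν₂-U-even′ = trans (cong (ν₂ ∘ U) 2*suc) (ν₂-U-even m)
  ... | inj₂ (n , refl) with even-or-odd n
  ...   | inj₁ (p , refl) =
    p , refl , gap⇒ν₂G (2 * p) M _ (subst (λ ν → 1 + 2 * (2 * p) + 2 * suc M ≤ 2 * ν) (ν₂-U-1mod4 p) gap)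
  ...   | inj₂ (p , refl) = ⊥-elim (no-gap (1 + 2 * (1 + 2 * p)) (1 + 2 * p) M (n≤1+n _)
                                        (subst (λ ν → 1 + 2 * (1 + 2 * p) + 2 * suc M ≤ 2 * ν) ν₂-U-3mod4′ gap))
    where
    ν₂-U-3mod4′ : ν₂ (U (1 + 2 * (1 + 2 * p))) ≡ 1 + 2 * p
    ν₂-U-3mod4′ = trans (cong (ν₂ ∘ U) (index p)) (ν₂-U-3mod4 p)
      where
      index : ∀ p → 1 + 2 * (1 + 2 * p) ≡ 3 + 2 * (2 * p)
      index = solve-∀

module G-Lipschitz where
  open import Data.Integer
  open import Data.Integer.Properties using (pos-+; pos-*)
  open import Data.Integer.Tactic.RingSolver using (solve-∀)
  import Data.Nat as ℕ
  import Data.Nat.Properties as ℕP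
  import Data.Nat.Tactic.RingSolver as ℕ-Ring
  import Data.Nat.Divisibility as ℕD
  open ℕ using (ℕ)
  open import Data.Product using (_×_; _,_; proj₁; proj₂; ∃-syntax)
  open import Data.Integer.Divisibility.Signed using (_∣_)
  open import Relation.Nullary.Decidable using (from-yes)
  open import Relation.Binary.PropositionalEquality
  open Congruence
  open LinearRecurrence
  open Sequence using (Y; G; G-definition)

  Y-recurrence : Recurrence (λ m → + Y m) 1 (+ 78) (- + 63) (+ 18)
  Y-recurrence .at p = trans (cong +_ (Sequence.Y-rec p)) (cast (Y (2 ℕ.+ p)) (Y (1 ℕ.+ p)) (Y p))
    where
    cast : ∀ a b c → + (78 ℕ.* a ℕ.+ 63 ℕ.* b ℕ.+ 18 ℕ.* c) ≡ + 78 * + a - - + 63 * + b + + 18 * + c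
    cast a b c = begin
      + (78 ℕ.* a ℕ.+ 63 ℕ.* b ℕ.+ 18 ℕ.* c)                ≡⟨ pos-+ (78 ℕ.* a ℕ.+ 63 ℕ.* b) (18 ℕ.* c) ⟩
      + (78 ℕ.* a ℕ.+ 63 ℕ.* b) + + (18 ℕ.* c)              ≡⟨ cong (_+ + (18 ℕ.* c)) (pos-+ (78 ℕ.* a) (63 ℕ.* b)) ⟩
      + (78 ℕ.* a) + + (63 ℕ.* b) + + (18 ℕ.* c)            ≡⟨ cong₂ (λ x y → x + y + + (18 ℕ.* c)) (pos-* 78 a) (pos-* 63 b) ⟩
      + 78 * + a + + 63 * + b + + (18 ℕ.* c)                ≡⟨ cong (λ z → + 78 * + a + + 63 * + b + z) (pos-* 18 c) ⟩
      + 78 * + a + + 63 * + b + + 18 * + c                  ≡⟨ sign-flip (+ a) (+ b) (+ c) ⟩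
      + 78 * + a - - + 63 * + b + + 18 * + c                ∎
      where
      open ≡-Reasoning
      sign-flip : ∀ a b c → + 78 * a + + 63 * b + + 18 * c ≡ + 78 * a - - + 63 * b + + 18 * c
      sign-flip = solve-∀

  -- F q = G (3 + q): the congruences for G only hold from index 3 on.
  opaque
    F : ℕ → ℤ
    F q = + Y (6 ℕ.+ 2 ℕ.* q)

    F-definition : ∀ q → F q ≡ + Y (6 ℕ.+ 2 ℕ.* q)
    F-definition q = refl

  F-recurrence : Recurrence F 1 (+ 6210) (+ 1161) (+ 324)
  F-recurrence = Recurrence-cong (λ q → sym (F-definition q)) (Recurrence-affine 6 2 (Recurrence-double Y-recurrence))

  F-admissible : Admissible 1 (+ 6210) (+ 1161) (+ 324)
  F-admissible = ≡-mod-intro (+ 1552) refl , ≡-mod-intro (+ 290) refl , ≡-mod-intro (+ 81) refl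

  Window : ℕ → Set
  Window q = F q ≡ 0ℤ mod 4 × F (1 ℕ.+ q) ≡ 0ℤ mod 4 × F (2 ℕ.+ q) ≡ 0ℤ mod 4
           × F (1 ℕ.+ q) - F q ≡ + 4 mod 8 × F (2 ℕ.+ q) - F (1 ℕ.+ q) ≡ + 4 mod 8

  opaque
    unfolding F
    window-0 : Window 0
    window-0 = from-yes (F 0 ≡? 0ℤ mod 4) , from-yes (F 1 ≡? 0ℤ mod 4) , from-yes (F 2 ≡? 0ℤ mod 4)
             , from-yes (F 1 - F 0 ≡? + 4 mod 8) , from-yes (F 2 - F 1 ≡? + 4 mod 8)

  window : ∀ q → Window q
  window ℕ.zero = window-0
  window (ℕ.suc q) with window q
  ... | F₀≡0 , F₁≡0 , F₂≡0 , _ , d₂≡4 = F₁≡0 , F₂≡0 , F₃≡0 , d₂≡4 , d₃≡4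
    where
    d₃≡4 : F (3 ℕ.+ q) - F (2 ℕ.+ q) ≡ + 4 mod 8
    d₃≡4 = ≡-mod-trans (≡-mod-weaken (ℕD.divides 2 refl)
                         (second-difference F-recurrence F-admissible q F₀≡0 F₁≡0 F₂≡0)) d₂≡4
    F₃≡0 : F (3 ℕ.+ q) ≡ 0ℤ mod 4
    F₃≡0 = ≡-mod-trans (≡-mod-from-difference (≡-mod-trans (≡-mod-weaken (ℕD.divides 2 refl) d₃≡4) (≡-mod-self 4)))
                       F₂≡0

  open Lipschitz F-recurrence F-admissible
    (λ q → proj₁ (window q)) (λ q → proj₁ (proj₂ (proj₂ (proj₂ (window q)))))

  G≡F : ∀ q → + G (3 ℕ.+ q) ≡ F q
  G≡F q = trans (cong +_ (trans (G-definition (3 ℕ.+ q)) (cong Y (index q)))) (sym (F-definition q))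
    where
    index : ∀ q → 2 ℕ.* (3 ℕ.+ q) ≡ 6 ℕ.+ 2 ℕ.* q
    index = ℕ-Ring.solve-∀

  above-3 : ∀ {p} → 3 ℕ.≤ p → ∃[ q ] p ≡ 3 ℕ.+ q
  above-3 {p} 3≤p = p ℕ.∸ 3 , sym (ℕP.m+[n∸m]≡n 3≤p)

  shifted-difference : ∀ c a b → + (c ℕ.+ a) - + (c ℕ.+ b) ≡ + a - + b
  shifted-difference c a b = trans (cong₂ _-_ (pos-+ c a) (pos-+ c b)) (cancel (+ c) (+ a) (+ b))
    where
    cancel : ∀ c a b → c + a - (c + b) ≡ a - b
    cancel = solve-∀

  G≡0 : ∀ p → 3 ℕ.< p → + G p ≡ 0ℤ mod 4
  G≡0 p 3<p with above-3 (ℕP.<⇒≤ 3<p)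
  ... | q , refl = subst (_≡ 0ℤ mod 4) (sym (G≡F q)) (proj₁ (window q))

  G-lipschitz : ∀ j a b → 2 ℕ.^ j ℕ.+ 3 ℕ.≤ a → 2 ℕ.^ j ℕ.+ 3 ℕ.≤ b → + a ≡ + b mod 2 ℕ.^ j →
                + G a - + G b ≡ + 4 * (+ a - + b) mod 2 ℕ.^ (3 ℕ.+ j)
  G-lipschitz j a b h+3≤a h+3≤b a≡b
    with above-3 (ℕP.≤-trans (ℕP.m≤n+m 3 _) h+3≤a) | above-3 (ℕP.≤-trans (ℕP.m≤n+m 3 _) h+3≤b)
  ... | a′ , refl | b′ , refl =
    subst₂ (λ x y → x ≡ y mod 2 ℕ.^ (3 ℕ.+ j))
      (sym (cong₂ _-_ (G≡F a′) (G≡F b′))) (cong (+ 4 *_) (sym (shifted-difference 3 a′ b′)))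
      (≡-mod-cast (8h≡2^[3+j] (2 ℕ.^ j))
        (lipschitz j a′ b′ (h≤ h+3≤a) (h≤ h+3≤b)
          (mod-intro (subst (+ 2 ℕ.^ j ∣_) (shifted-difference 3 a′ b′) (∣-difference a≡b)))))
    where
    h≤ : ∀ {x} → 2 ℕ.^ j ℕ.+ 3 ℕ.≤ 3 ℕ.+ x → 2 ℕ.^ j ℕ.≤ x
    h≤ {x} le = ℕP.+-cancelˡ-≤ 3 _ _ (subst (ℕ._≤ 3 ℕ.+ x) (ℕP.+-comm (2 ℕ.^ j) 3) le)
    8h≡2^[3+j] : ∀ h → 8 ℕ.* h ≡ 2 ℕ.* (2 ℕ.* (2 ℕ.* h))
    8h≡2^[3+j] = ℕ-Ring.solve-∀

module Limit where
  open import Data.Nat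
  open import Data.Nat.Properties
  open import Data.Nat.DivMod using (n%1≡0)
  open import Data.Bool using (true; false)
  open import Data.Integer as ℤ using (+_)
  open import Data.Integer.Properties using (pos-+; pos-*)
  open import Data.Product using (_,_)
  open import Data.Empty using (⊥-elim)
  open import Function.Bundles using (Equivalence)
  open import Relation.Nullary using (yes; no)
  open import Relation.Binary.PropositionalEquality
  open import Data.Nat.Tactic.RingSolver using (solve-∀)
  open Congruence
  open TwoAdic
  open Valuation using (ν₂≤; ≤ν₂⇒2^∣; 2^∣⇒≤ν₂; odd%2)
  open Sequence using (G; G>0; G-mono; ν₂-U-1mod4; gap⇒1mod4; ν₂G⇒gap)
  open G-Lipschitz using (G≡0; G-lipschitz)
  open Lifting using (large-base)
  open Lifting.Digits (λ p → + G p) 3 G≡0 G-lipschitz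

  -- ζ₀ = 1 + 4ξ, matching the indices 1 + 4p at which the gap can grow.
  ζ₀ : ℤ₂
  ζ₀ = true ∷₂ false ∷₂ ξ

  trunc-ζ₀ : ∀ k → trunc ζ₀ (2 + k) ≡ 1 + 2 * (2 * ρ k)
  trunc-ζ₀ k = trans (trunc-∷ true (false ∷₂ ξ) (suc k))
                     (cong (λ t → 1 + 2 * t) (trans (trunc-∷ false ξ k) (cong (2 *_) (trunc-ξ k))))

  residue-of-large-valuation : ∀ k p → 2 + (G (2 ^ k + 3) + k) ≤ ν₂ (G p) → + p ≡ + ρ k mod 2 ^ k
  residue-of-large-valuation k p ν-large =
    Equivalence.to (vanishing⇔residue k p large-p) (∣⇒≡0-mod (≤ν₂⇒2^∣ (G>0 p) 2+k≤ν))
    where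
    2+k≤ν : 2 + k ≤ ν₂ (G p)
    2+k≤ν = ≤-trans (+-monoʳ-≤ 2 (m≤n+m k _)) ν-large
    large-p : 2 ^ k + 3 ≤ p
    large-p with 2 ^ k + 3 ≤? p
    ... | yes 2^k+3≤p = 2^k+3≤p
    ... | no 2^k+3≰p = ⊥-elim (<⇒≱ (s≤s (≤-trans (m≤m+n _ k) (n≤1+n _))) (begin
      2 + (G (2 ^ k + 3) + k)    ≤⟨ ν-large ⟩
      ν₂ (G p)                   ≤⟨ ν₂≤ (G p) ⟩
      G p                        ≤⟨ G-mono (<⇒≤ (≰⇒> 2^k+3≰p)) ⟩
      G (2 ^ k + 3)              ∎))
      where open ≤-Reasoning

  index-congruence : ∀ {a b m} → + a ≡ + b mod m → + (1 + 2 * (2 * a)) ≡ + (1 + 2 * (2 * b)) mod 2 * (2 * m)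
  index-congruence {a} {b} {m} a≡b = subst₂ (λ x y → x ≡ y mod 2 * (2 * m)) (sym (cast a)) (sym (cast b))
                                       (≡-mod-+ˡ (+ 1) (≡-mod-scale 2 (≡-mod-scale 2 a≡b)))
    where
    cast : ∀ a → + (1 + 2 * (2 * a)) ≡ + 1 ℤ.+ + 2 ℤ.* (+ 2 ℤ.* + a)
    cast a = trans (pos-+ 1 (2 * (2 * a)))
                   (cong (λ z → + 1 ℤ.+ z) (trans (pos-* 2 (2 * a)) (cong (λ z → + 2 ℤ.* z) (pos-* 2 a))))

  index-bound : ∀ {r h} → r < h → 1 + 2 * (2 * r) < 2 * (2 * h)
  index-bound {r} {h} r<h = begin-strict
    1 + 2 * (2 * r)   <⟨ +-monoˡ-< (2 * (2 * r)) {1} {4} (s≤s (s≤s z≤n)) ⟩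
    4 + 2 * (2 * r)   ≡⟨ regroup r ⟩
    2 * (2 * suc r)   ≤⟨ *-monoʳ-≤ 2 (*-monoʳ-≤ 2 r<h) ⟩
    2 * (2 * h)       ∎
    where
    open ≤-Reasoning
    regroup : ∀ r → 4 + 2 * (2 * r) ≡ 2 * (2 * suc r)
    regroup = solve-∀

  ζ₀-limit : Property ζ₀
  ζ₀-limit i gap zero = 0 , λ n _ → n%1≡0 (i n)
  ζ₀-limit i gap (suc zero) with gap 1
  ... | N , after-N = N , residue
    where
    residue : ∀ n → N ≤ n → i n % 2 ≡ 1
    residue n N≤n with gap⇒1mod4 (i n) 0 (after-N n N≤n)
    ... | p , i≡1+4p , _ = trans (cong (_% 2) i≡1+4p) (odd%2 (2 * p))
  ζ₀-limit i gap (suc (suc k)) with gap (suc (G (2 ^ k + 3) + k))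
  ... | N , after-N = N , residue
    where
    instance _ = m^n≢0 2 (2 + k)
    residue : ∀ n → N ≤ n → i n % 2 ^ (2 + k) ≡ trunc ζ₀ (2 + k)
    residue n N≤n with gap⇒1mod4 (i n) (G (2 ^ k + 3) + k) (after-N n N≤n)
    ... | p , i≡1+4p , ν-large = begin
      i n % 2 ^ (2 + k)               ≡⟨ cong (_% 2 ^ (2 + k)) i≡1+4p ⟩
      (1 + 2 * (2 * p)) % 2 ^ (2 + k) ≡⟨ ≡-mod⇒%≡ (index-congruence (residue-of-large-valuation k p ν-large))
                                                   (index-bound (ρ<2^ k)) ⟩
      1 + 2 * (2 * ρ k)               ≡⟨ trunc-ζ₀ k ⟨
      trunc ζ₀ (2 + k)                ∎
      where open ≡-Reasoning

  witness : ℕ → ℕ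
  witness n = ρ n + 4 * 2 ^ n

  witness-index : ℕ → ℕ
  witness-index n = 1 + 2 * (2 * witness n)

  witness-valuation : ∀ n → 2 + n ≤ ν₂ (G (witness n))
  witness-valuation n = 2^∣⇒≤ν₂ (G>0 (witness n)) (≡0-mod⇒∣ (Equivalence.from
    (vanishing⇔residue n (witness n) (large-base (ρ n) 3 (2 ^ n) (m^n>0 2 n))) (offset⇒≡-mod (ρ n) 4 (2 ^ n))))

  witness-gap : ValuationGapDiverges witness-index
  witness-gap M = M , λ n M≤n → ≤-trans (+-monoʳ-≤ (witness-index n) (*-monoʳ-≤ 2 (n≤1+n M)))
    (subst (λ ν → witness-index n + 2 * suc M ≤ 2 * ν) (sym (ν₂-U-1mod4 (witness n)))
      (ν₂G⇒gap (2 * witness n) M _ (≤-trans (+-monoʳ-≤ 2 M≤n) (witness-valuation n))))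

theorem6p3 : ∃[ ζ ] (Property ζ × (∀ ζ′ → Property ζ′ → ∀ j → ζ′ j ≡ ζ j))
theorem6p3 = ζ₀ , ζ₀-limit , λ ζ′ ζ′-limit →
  limit-unique (ζ′-limit witness-index witness-gap) (ζ₀-limit witness-index witness-gap)
  where
  open Limit
  open TwoAdic using (limit-unique)
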